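{- For any finite sequence of channel actions $\sigma$, the set $I_\sigma=\bigcap_{k\in\mathbb{N}}\mathrm{Pre}[\sigma^k](\Sigma^*)$ is an upward-closed subset of $\Sigma^*$ (w.r.t. the subword ordering), and it is either empty or has a single minimal element.
   Context: Channel actions over a finite alphabet $\Sigma$ are $!w$ and $?w$ ($w\in\Sigma^*$). $\sqsubseteq$ is the scattered subword ordering. Lossy semantics: $x\xrightarrow{!w}y$ iff $y\sqsubseteq xw$, $x\xrightarrow{?w}y$ iff $wy\sqsubseteq x$, extended to sequences by composition. For a set $T$ of words, $\mathrm{Pre}[\sigma](T)=\{z : \exists t\in T,\ z\xrightarrow{\sigma}t\}$; $\sigma^k$ is the $k$-fold concatenation ($\sigma^0$ empty). -}

module Defs where

open import Data.Nat using (ℕ)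
open import Data.Fin using (Fin)
open import Data.List using (List; []; _∷_; _++_; concat; replicate)
open import Data.List.Relation.Binary.Sublist.Propositional using (_⊆_)
open import Data.Product using (Σ; ∃; _×_)
open import Relation.Binary.PropositionalEquality using (_≡_)

Word : ℕ → Set
Word n = List (Fin n)

_⊑_ : ∀ {n} → Word n → Word n → Set
x ⊑ y = x ⊆ y

data Action (n : ℕ) : Set where
  send : Word n → Action n
  recv : Word n → Action n

-- Lossy semantics of a single action.
Step : ∀ {n} → Word n → Action n → Word n → Set
Step x (send w) y = y ⊑ (x ++ w)
Step x (recv w) y = (w ++ y) ⊑ x

Steps : ∀ {n} → Word n → List (Action n) → Word n → Set
Steps x []      y = x ≡ y
Steps x (a ∷ σ) y = ∃ λ z → Step x a z × Steps z σ y

Pre : ∀ {n} → List (Action n) → (Word n → Set) → Word n → Set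
Pre σ T z = ∃ λ t → T t × Steps z σ t

Univ : ∀ {n} → Word n → Set
Univ _ = Data.Unit.⊤
  where import Data.Unit

_^^_ : ∀ {n} → List (Action n) → ℕ → List (Action n)
σ ^^ k = concat (replicate k σ)

I : ∀ {n} → List (Action n) → Word n → Set
I σ z = ∀ (k : ℕ) → Pre (σ ^^ k) Univ z

UpwardClosed : ∀ {n} → (Word n → Set) → Set
UpwardClosed {n} P = ∀ (x y : Word n) → x ⊑ y → P x → P y

Minimal : ∀ {n} → (Word n → Set) → Word n → Set
Minimal {n} P m = P m × (∀ (z : Word n) → P z → z ⊑ m → z ≡ m)

UniqueMinimal : ∀ {n} → (Word n → Set) → Set
UniqueMinimal {n} P = Σ (Word n) λ m → Minimal P m × (∀ (m′ : Word n) → Minimal P m′ → m′ ≡ m)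

-- Lossy channels make Pre[σ] of an upward-closed set ↑m upward closed again, with a least
-- element obtained from m by prepending received words and greedily stripping sent ones.
-- Hence Pre[σ^k](Σ*) = ↑m_k with m_k = F^k [] for a monotone F, so I_σ = ⋂_k ↑m_k. If I_σ
-- contains x, every m_k is a subword of x; the chain m_0 ⊑ m_1 ⊑ ⋯ then cannot grow in
-- length forever and reaches a fixpoint M of F. By Kleene's argument every m_k is below M,
-- so M is the least element of I_σ.
module Submission where

open import Defs
open import Level using (Level)
open import Data.Nat using (ℕ; zero; suc; _≤_; z≤n; s≤s; _≤?_)
open import Data.Nat.Properties using (≤-antisym; <-irrefl; ≤-trans; ≰⇒>)
open import Data.Nat.GeneralisedArithmetic using (fold)
open import Data.List using (List; []; _∷_; _++_; foldr; length; reverse)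
open import Data.List.Properties using (foldr-++; reverse-++; reverse-involutive)
open import Data.List.Relation.Binary.Pointwise using (Pointwise-≡⇒≡)
open import Data.List.Relation.Binary.Sublist.Propositional
  using (_⊆_; _∷_; _∷ʳ_; ⊆-refl; ⊆-trans; ⊆-antisym; minimum)
open import Data.List.Relation.Binary.Sublist.Propositional.Properties
  using (length-mono-≤; to-≋; reverse⁺; reverse⁻; ++⁺; ∷⁻; ∷ʳ⁻)
open import Data.Fin.Properties using () renaming (_≟_ to _≟ᶠ_)
open import Data.Product using (_×_; ∃; _,_)
open import Data.Sum using (_⊎_; inj₁; inj₂)
open import Data.Empty using (⊥-elim)
open import Data.Unit using (tt)
open import Relation.Nullary using (yes; no)
open import Relation.Binary.Definitions using (DecidableEquality)
open import Relation.Binary.PropositionalEquality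
  using (_≡_; refl; sym; trans; cong; subst)

private
  variable
    a : Level
    A : Set a

⊆∧length-≥⇒≡ : {xs ys : List A} → xs ⊆ ys → length ys ≤ length xs → xs ≡ ys
⊆∧length-≥⇒≡ xs⊆ys ∣ys∣≤∣xs∣ =
  Pointwise-≡⇒≡ (to-≋ (≤-antisym (length-mono-≤ xs⊆ys) ∣ys∣≤∣xs∣) xs⊆ys)

module Residuals (_≟_ : DecidableEquality A) where

  leftResidual : List A → List A → List A
  leftResidual []      m       = m
  leftResidual (b ∷ w) []      = []
  leftResidual (b ∷ w) (c ∷ m) with c ≟ b
  ... | yes _ = leftResidual w m
  ... | no  _ = leftResidual w (c ∷ m)

  leftResidual-sound : ∀ w m {z} → leftResidual w m ⊆ z → m ⊆ w ++ z
  leftResidual-sound []      m       r = r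
  leftResidual-sound (b ∷ w) []      r = minimum _
  leftResidual-sound (b ∷ w) (c ∷ m) r with c ≟ b
  ... | yes c≡b = c≡b ∷ leftResidual-sound w m r
  ... | no  _   = b ∷ʳ leftResidual-sound w (c ∷ m) r

  leftResidual-least : ∀ w m {z} → m ⊆ w ++ z → leftResidual w m ⊆ z
  leftResidual-least []      m       m⊆z = m⊆z
  leftResidual-least (b ∷ w) []      _   = minimum _
  leftResidual-least (b ∷ w) (c ∷ m) m⊆ with c ≟ b
  ... | yes _   = leftResidual-least w m (∷⁻ m⊆)
  ... | no  c≢b = leftResidual-least w (c ∷ m) (∷ʳ⁻ c≢b m⊆)

  rightResidual : List A → List A → List A
  rightResidual w m = reverse (leftResidual (reverse w) (reverse m))

  rightResidual-sound : ∀ w m {z} → rightResidual w m ⊆ z → m ⊆ z ++ w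
  rightResidual-sound w m {z} r = reverse⁻ (subst (reverse m ⊆_) (sym (reverse-++ z w))
    (leftResidual-sound (reverse w) (reverse m)
      (subst (_⊆ reverse z) (reverse-involutive _) (reverse⁺ r))))

  rightResidual-least : ∀ w m {z} → m ⊆ z ++ w → rightResidual w m ⊆ z
  rightResidual-least w m {z} m⊆ = reverse⁻ (subst (_⊆ reverse z)
    (sym (reverse-involutive _))
    (leftResidual-least (reverse w) (reverse m)
      (subst (reverse m ⊆_) (reverse-++ z w) (reverse⁺ m⊆))))

module KleeneIteration (f : List A → List A)
                       (f-mono : ∀ {x y} → x ⊆ y → f x ⊆ f y) where

  iterate : ℕ → List A
  iterate = fold [] f

  iterate-⊆-suc : ∀ k → iterate k ⊆ iterate (suc k)
  iterate-⊆-suc zero    = minimum _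
  iterate-⊆-suc (suc k) = f-mono (iterate-⊆-suc k)

  iterate-⊆-prefixpoint : ∀ {p} → f p ⊆ p → ∀ k → iterate k ⊆ p
  iterate-⊆-prefixpoint fp⊆p zero    = minimum _
  iterate-⊆-prefixpoint fp⊆p (suc k) = ⊆-trans (f-mono (iterate-⊆-prefixpoint fp⊆p k)) fp⊆p

  Stable : ℕ → Set _
  Stable k = f (iterate k) ≡ iterate k

  stable⊎length-≥ : ∀ k → (∃ λ j → Stable j) ⊎ k ≤ length (iterate k)
  stable⊎length-≥ zero = inj₂ z≤n
  stable⊎length-≥ (suc k) with stable⊎length-≥ k
  ... | inj₁ stable = inj₁ stable
  ... | inj₂ k≤∣iₖ∣ with length (iterate (suc k)) ≤? length (iterate k)
  ...   | yes ∣iₖ₊₁∣≤∣iₖ∣ = inj₁ (k , sym (⊆∧length-≥⇒≡ (iterate-⊆-suc k) ∣iₖ₊₁∣≤∣iₖ∣))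
  ...   | no  ∣iₖ₊₁∣≰∣iₖ∣ = inj₂ (≤-trans (s≤s k≤∣iₖ∣) (≰⇒> ∣iₖ₊₁∣≰∣iₖ∣))

  bounded⇒stable : ∀ {x} → (∀ k → iterate k ⊆ x) → ∃ λ j → Stable j
  bounded⇒stable {x} bounded with stable⊎length-≥ (suc (length x))
  ... | inj₁ stable = stable
  ... | inj₂ long   =
    ⊥-elim (<-irrefl refl (≤-trans long (length-mono-≤ (bounded (suc (length x))))))

Least : ∀ {n} → (Word n → Set) → Word n → Set
Least P m = P m × (∀ z → P z → m ⊑ z)

least⇒uniqueMinimal : ∀ {n} {P : Word n → Set} → ∃ (Least P) → UniqueMinimal P
least⇒uniqueMinimal (m , Pm , m-least) =
  m , (Pm , λ z Pz z⊑m → ⊆-antisym z⊑m (m-least z Pz)) ,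
  λ m′ (Pm′ , m′-minimal) → sym (m′-minimal m Pm (m-least m′ Pm′))

module _ {n : ℕ} where

  open Residuals (_≟ᶠ_ {n})

  ↑_ : Word n → Word n → Set
  ↑ m = m ⊑_

  minPre : Action n → Word n → Word n
  minPre (send w) m = rightResidual w m
  minPre (recv w) m = w ++ m

  minPre-sound : ∀ a m {z} → minPre a m ⊑ z → Step z a m
  minPre-sound (send w) m r = rightResidual-sound w m r
  minPre-sound (recv w) m r = r

  minPre-least : ∀ a m {z y} → Step z a y → m ⊑ y → minPre a m ⊑ z
  minPre-least (send w) m z→y m⊑y = rightResidual-least w m (⊆-trans m⊑y z→y)
  minPre-least (recv w) m z→y m⊑y = ⊆-trans (++⁺ ⊆-refl m⊑y) z→y

  minPres : List (Action n) → Word n → Word n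
  minPres σ m = foldr minPre m σ

  minPres-sound : ∀ σ m {z} → minPres σ m ⊑ z → Pre σ (↑ m) z
  minPres-sound []      m r = _ , r , refl
  minPres-sound (a ∷ σ) m r with minPres-sound σ m ⊆-refl
  ... | t , m⊑t , steps = t , m⊑t , (minPres σ m , minPre-sound a (minPres σ m) r , steps)

  minPres-least : ∀ σ m {z} → Pre σ (↑ m) z → minPres σ m ⊑ z
  minPres-least []      m (t , m⊑t , refl)          = m⊑t
  minPres-least (a ∷ σ) m (t , m⊑t , y , z→y , steps) =
    minPre-least a (minPres σ m) z→y (minPres-least σ m (t , m⊑t , steps))

  minPres-mono : ∀ σ {m m′} → m ⊑ m′ → minPres σ m ⊑ minPres σ m′
  minPres-mono σ {m} {m′} m⊑m′ with minPres-sound σ m′ ⊆-refl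
  ... | t , m′⊑t , steps = minPres-least σ m (t , ⊆-trans m⊑m′ m′⊑t , steps)

  minPres-^^ : ∀ σ k m → minPres (σ ^^ k) m ≡ fold m (minPres σ) k
  minPres-^^ σ zero    m = refl
  minPres-^^ σ (suc k) m =
    trans (foldr-++ minPre m σ (σ ^^ k)) (cong (minPres σ) (minPres-^^ σ k m))

  module _ (σ : List (Action n)) where

    open KleeneIteration (minPres σ) (minPres-mono σ)

    I⇒iterate-⊑ : ∀ {z} → I σ z → ∀ k → iterate k ⊑ z
    I⇒iterate-⊑ {z} z∈I k with z∈I k
    ... | t , _ , steps = subst (_⊑ z) (minPres-^^ σ k [])
                            (minPres-least (σ ^^ k) [] (t , minimum t , steps))

    iterate-⊑⇒I : ∀ {z} → (∀ k → iterate k ⊑ z) → I σ z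
    iterate-⊑⇒I {z} above k with minPres-sound (σ ^^ k) []
                                   (subst (_⊑ z) (sym (minPres-^^ σ k [])) (above k))
    ... | t , _ , steps = t , tt , steps

    I-upwardClosed : UpwardClosed (I σ)
    I-upwardClosed x y x⊑y x∈I =
      iterate-⊑⇒I (λ k → ⊆-trans (I⇒iterate-⊑ x∈I k) x⊑y)

    I-least : ∀ {x} → I σ x → ∃ (Least (I σ))
    I-least x∈I with bounded⇒stable (I⇒iterate-⊑ x∈I)
    ... | j , stable =
      iterate j ,
      iterate-⊑⇒I (iterate-⊆-prefixpoint (subst (_⊆ iterate j) (sym stable) ⊆-refl)) ,
      λ z z∈I → I⇒iterate-⊑ z∈I j

lemma16 : ∀ {n : ℕ} (σ : List (Action n)) →
    UpwardClosed (I σ) × ((∃ λ z → I σ z) → UniqueMinimal (I σ))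
lemma16 σ = I-upwardClosed σ , λ (_ , x∈I) → least⇒uniqueMinimal (I-least σ x∈I)
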